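{- For every integer $k\ge 0$, $a_k(3) = \binom{k+2}{k} + 1$.
   Context: Let $(F_n)_{n\ge 1}$ be the Fibonacci sequence with $F_1=F_2=1$ and $F_{n+2}=F_{n+1}+F_n$. Define $a_0(n)=F_n$ for $n\ge 1$, and for $k\ge 1$ define $a_k(n)=\sum_{i=1}^n a_{k-1}(i)$ for $n\ge 1$. -}

module Defs where

open import Data.Nat using (ℕ; zero; suc; _+_)

-- Fibonacci: fib 1 = fib 2 = 1, fib (n+2) = fib (n+1) + fib n.
-- (fib 0 = 0 is only an auxiliary value; the sequence is used for n ≥ 1.)
fib : ℕ → ℕ
fib zero = 0
fib (suc zero) = 1
fib (suc (suc n)) = fib (suc n) + fib n

sum1to : (ℕ → ℕ) → ℕ → ℕ
sum1to f zero = 0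
sum1to f (suc n) = sum1to f n + f (suc n)

a : ℕ → ℕ → ℕ
a zero n = fib n
a (suc k) n = sum1to (a k) n

-- Summing the columns gives a k 1 = 1 and a k 2 = k + 1, so the third column obeys
-- a (k+1) 3 = (k + 2) + a k 3. Since k + 2 = (k + 2) C (k + 1), this is Pascal's rule
-- (k + 2) C k + (k + 2) C (k + 1) = (k + 3) C (k + 1) shifted by the constant 1.
module Submission where

open import Defs
open import Data.Nat using (ℕ; zero; suc; _+_)
open import Data.Nat.Properties using (+-assoc; +-comm)
open import Data.Nat.Combinatorics using (_C_; nCn≡1; nCk+nC[k+1]≡[n+1]C[k+1])
open import Relation.Binary.PropositionalEquality using (_≡_; refl; cong; cong₂; sym)
open Relation.Binary.PropositionalEquality.≡-Reasoning

a-at-1 : ∀ k → a k 1 ≡ 1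
a-at-1 zero    = refl
a-at-1 (suc k) = a-at-1 k

a-at-2 : ∀ k → a k 2 ≡ suc k
a-at-2 zero    = refl
a-at-2 (suc k) = cong₂ _+_ (a-at-1 k) (a-at-2 k)

[1+n]Cn≡1+n : ∀ n → suc n C n ≡ suc n
[1+n]Cn≡1+n zero    = refl
[1+n]Cn≡1+n (suc n) = begin
  suc (suc n) C suc n           ≡⟨ sym (nCk+nC[k+1]≡[n+1]C[k+1] (suc n) n) ⟩
  suc n C n + suc n C suc n     ≡⟨ cong₂ _+_ ([1+n]Cn≡1+n n) (nCn≡1 (suc n)) ⟩
  suc n + 1                     ≡⟨ +-comm (suc n) 1 ⟩
  suc (suc n)                   ∎

a-at-3 : ∀ k → a k 3 ≡ suc (suc k) C k + 1
a-at-3 zero    = refl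
a-at-3 (suc k) = begin
  (a k 1 + a k 2) + a k 3                       ≡⟨ cong₂ _+_ (cong₂ _+_ (a-at-1 k) (a-at-2 k)) (a-at-3 k) ⟩
  suc (suc k) + (suc (suc k) C k + 1)           ≡⟨ regroup (suc (suc k)) (suc (suc k) C k) ⟩
  (suc (suc k) C k + suc (suc k)) + 1           ≡⟨ cong (λ m → (suc (suc k) C k + m) + 1) (sym ([1+n]Cn≡1+n (suc k))) ⟩
  (suc (suc k) C k + suc (suc k) C suc k) + 1   ≡⟨ cong (_+ 1) (nCk+nC[k+1]≡[n+1]C[k+1] (suc (suc k)) k) ⟩
  suc (suc (suc k)) C suc k + 1                 ∎
  where
  regroup : ∀ m c → m + (c + 1) ≡ (c + m) + 1
  regroup m c = begin
    m + (c + 1)  ≡⟨ sym (+-assoc m c 1) ⟩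
    (m + c) + 1  ≡⟨ cong (_+ 1) (+-comm m c) ⟩
    (c + m) + 1  ∎

lemma2p1 : (k : ℕ) → a k 3 ≡ ((k + 2) C k) + 1
lemma2p1 k rewrite +-comm k 2 = a-at-3 k
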